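{- Suppose that there is a pair of disjoint partial $3$-GDDs of type $g^tu^1$ on a set $X$, with the same groups, where $U\subseteq X$ is the group of size $u$, and let $L_1,L_2$ be their leaves. If, for $j=1,2$, the pairs of $L_j$ can be partitioned into $s$ disjoint $1$-factors $F_1^j,\dots,F_s^j$ of $X\setminus U$ such that $F_i^1\cap F_i^2=\emptyset$ for each $1\leq i\leq s$, then there exists a pair of disjoint $3$-GDDs of type $g^t(u+s)^1$.
   Context: A partial $3$-GDD is a triple $(X,\mathcal G,\mathcal A)$ where $\mathcal G$ is a partition of the finite set $X$ into groups and $\mathcal A$ is a set of $3$-subsets (blocks) of $X$ such that a block and a group share at most one point and every pair of points from distinct groups lies in at most one block. Its leave is the graph on $X$ whose edges are the pairs of points from distinct groups lying in no block. A $3$-GDD is a partial $3$-GDD with empty leave. Type $g^tu^1$ means $t$ groups of size $g$ and one group of size $u$. Two (partial) $3$-GDDs with the same point set and the same groups are disjoint if their block sets are disjoint. A $1$-factor of a set $Y$ is a set of pairwise disjoint $2$-subsets of $Y$ whose union is $Y$. -}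

module Defs where

open import Data.Nat using (ℕ; suc)
open import Data.Fin using (Fin; _<_; fromℕ; inject₁)
open import Data.Product using (Σ; ∃; _×_; _,_)
open import Data.Sum using (_⊎_)
open import Data.List using (List)
open import Data.List.Membership.Propositional using (_∈_)
open import Relation.Nullary using (¬_)
open import Relation.Binary.PropositionalEquality using (_≡_; _≢_)
open import Function.Bundles using (_↔_)

-- Groups are given by a labelling
--   grp : Fin n → Fin (suc t)
-- where the labels  inject₁ i  (i : Fin t) are the t groups of size g
-- and the label  fromℕ t  is the special group U (of size u).
Labelling : ℕ → ℕ → Set
Labelling n t = Fin n → Fin (suc t)

GroupOf : ∀ {n t} → Labelling n t → Fin (suc t) → Set
GroupOf {n} grp i = Σ (Fin n) (λ x → grp x ≡ i)

HasType : ∀ {n} (g t u : ℕ) → Labelling n t → Set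
HasType g t u grp =
  ((i : Fin t) → GroupOf grp (inject₁ i) ↔ Fin g) ×
  (GroupOf grp (fromℕ t) ↔ Fin u)

InU : ∀ {n t} → Labelling n t → Fin n → Set
InU {t = t} grp x = grp x ≡ fromℕ t

-- A block is a 3-subset {a,b,c}, represented canonically as (a , b , c)
-- with a < b < c.
Block : ℕ → Set
Block n = Fin n × Fin n × Fin n

Sorted : ∀ {n} → Block n → Set
Sorted (a , b , c) = a < b × b < c

_∈B_ : ∀ {n} → Fin n → Block n → Set
x ∈B (a , b , c) = x ≡ a ⊎ x ≡ b ⊎ x ≡ c

PairIn : ∀ {n} → Fin n → Fin n → Block n → Set
PairIn x y b = x ≢ y × x ∈B b × y ∈B b

record IsPartialGDD {n t} (grp : Labelling n t) (B : List (Block n)) : Set where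
  field
    sorted     : ∀ b → b ∈ B → Sorted b
    transverse : ∀ b → b ∈ B → ∀ x y → x ∈B b → y ∈B b → grp x ≡ grp y → x ≡ y
    atMostOne  : ∀ x y → grp x ≢ grp y → ∀ b b' → b ∈ B → b' ∈ B →
                 PairIn x y b → PairIn x y b' → b ≡ b'

Leave : ∀ {n t} → Labelling n t → List (Block n) → Fin n → Fin n → Set
Leave grp B x y = grp x ≢ grp y × (∀ b → b ∈ B → ¬ PairIn x y b)

IsGDD : ∀ {n t} (grp : Labelling n t) (B : List (Block n)) → Set
IsGDD grp B = IsPartialGDD grp B × (∀ x y → ¬ Leave grp B x y)

-- block sets disjoint (blocks are canonical, so set equality is ≡)
DisjointBlocks : ∀ {n} → List (Block n) → List (Block n) → Set
DisjointBlocks B₁ B₂ = ∀ b → b ∈ B₁ → ¬ (b ∈ B₂)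

-- A set of 2-subsets, represented canonically as pairs (a , b) with a < b.
PairSet : ℕ → Set
PairSet n = List (Fin n × Fin n)

HasEdge : ∀ {n} → PairSet n → Fin n → Fin n → Set
HasEdge F x y = (x , y) ∈ F ⊎ (y , x) ∈ F

record IsOneFactor {n} (Y : Fin n → Set) (F : PairSet n) : Set where
  field
    canonical : ∀ a b → (a , b) ∈ F → a < b
    inside    : ∀ a b → (a , b) ∈ F → Y a × Y b
    covers    : ∀ x → Y x → ∃ λ y → HasEdge F x y
    disjoint  : ∀ x y z → HasEdge F x y → HasEdge F x z → y ≡ z

record LeaveFactorisation {n t} (grp : Labelling n t) (B : List (Block n))
                          (s : ℕ) (F : Fin s → PairSet n) : Set where
  field
    factors   : ∀ i → IsOneFactor (λ x → ¬ InU grp x) (F i)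
    leave⊆    : ∀ x y → Leave grp B x y → ∃ λ i → HasEdge (F i) x y
    ⊆leave    : ∀ i x y → HasEdge (F i) x y → Leave grp B x y
    pairwise  : ∀ i j x y → HasEdge (F i) x y → HasEdge (F j) x y → i ≡ j

-- Add s new points ∞₁, …, ∞ₛ to the group U.  Each design keeps its blocks and gains
-- the triangles {a, c, ∞ᵢ} for the edges {a, c} of its i-th factor.  An old pair from
-- distinct groups is covered by an old block or, lying in the leave, by exactly one
-- factor edge; a pair {x, ∞ᵢ} is covered exactly once because Fᵢ is a 1-factor of
-- X ∖ U.  A triangle common to both designs would be an edge common to Fᵢ¹ and Fᵢ²,
-- so the two extended designs stay disjoint.

module Submission where

open import Defs
open import Data.Nat using (ℕ; suc; _+_)
open import Data.Nat.Properties using (≤-trans; m≤m+n)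
open import Data.Fin using (Fin; _<_; _↑ˡ_; _↑ʳ_; splitAt; toℕ; fromℕ; inject₁)
open import Data.Fin.Properties
  using (_≟_; <-asym; ↑ˡ-injective; ↑ʳ-injective; toℕ-↑ˡ; toℕ-↑ʳ; toℕ<n;
         splitAt-↑ˡ; splitAt-↑ʳ; splitAt⁻¹-↑ˡ; splitAt⁻¹-↑ʳ; fromℕ≢inject₁; +↔⊎)
open import Data.Empty using (⊥-elim)
open import Data.Empty.Polymorphic using (⊥)
open import Data.Product using (Σ; ∃; _×_; _,_; proj₁; proj₂)
open import Data.Product.Function.Dependent.Propositional using (Σ-↔)
open import Data.Sum using (_⊎_; inj₁; inj₂; [_,_]′)
open import Data.Sum.Function.Propositional using (_⊎-↔_)
open import Data.List using (List; _++_; map; concatMap; allFin)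
open import Data.List.Membership.Propositional using (_∈_; find; lose)
open import Data.List.Membership.Propositional.Properties
  using (∈-map⁺; ∈-map⁻; ∈-++⁺ˡ; ∈-++⁺ʳ; ∈-++⁻; ∈-concatMap⁺; ∈-concatMap⁻; ∈-allFin)
open import Function using (_∘_)
open import Level using (0ℓ)
open import Function.Bundles using (_↔_; mk↔ₛ′)
open import Function.Definitions using (Injective)
open import Function.Properties.Inverse using (↔-refl; ↔-sym; ↔-trans)
open import Function.Related.TypeIsomorphisms using (Σ-distribʳ-⊎; ⊎-identityʳ)
open import Relation.Nullary using (¬_)
open import Relation.Binary.PropositionalEquality
  using (_≡_; _≢_; refl; sym; trans; cong; subst; ≢-sym)
open import Axiom.UniquenessOfIdentityProofs using (module Decidable⇒UIP)

mapBlock : ∀ {m n} → (Fin m → Fin n) → Block m → Block n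
mapBlock f (a , b , c) = f a , f b , f c

module _ {m n} (f : Fin m → Fin n) where

  ∈B-map⁺ : ∀ {x} b → x ∈B b → f x ∈B mapBlock f b
  ∈B-map⁺ _ (inj₁ refl)        = inj₁ refl
  ∈B-map⁺ _ (inj₂ (inj₁ refl)) = inj₂ (inj₁ refl)
  ∈B-map⁺ _ (inj₂ (inj₂ refl)) = inj₂ (inj₂ refl)

  ∈B-map⁻ : ∀ {y} b → y ∈B mapBlock f b → ∃ λ x → y ≡ f x × x ∈B b
  ∈B-map⁻ (a , _ , _) (inj₁ refl)        = a , refl , inj₁ refl
  ∈B-map⁻ (_ , b , _) (inj₂ (inj₁ refl)) = b , refl , inj₂ (inj₁ refl)
  ∈B-map⁻ (_ , _ , c) (inj₂ (inj₂ refl)) = c , refl , inj₂ (inj₂ refl)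

  module _ (f-injective : Injective _≡_ _≡_ f) where

    ∈B-map⁻-injective : ∀ {x} b → f x ∈B mapBlock f b → x ∈B b
    ∈B-map⁻-injective b fx∈ with ∈B-map⁻ b fx∈
    ... | x′ , fx≡fx′ , x′∈ = subst (_∈B b) (sym (f-injective fx≡fx′)) x′∈

    PairIn-map⁺ : ∀ {x y} b → PairIn x y b → PairIn (f x) (f y) (mapBlock f b)
    PairIn-map⁺ b (x≢y , x∈ , y∈) = x≢y ∘ f-injective , ∈B-map⁺ b x∈ , ∈B-map⁺ b y∈

    PairIn-map⁻ : ∀ {x y} b → PairIn (f x) (f y) (mapBlock f b) → PairIn x y b
    PairIn-map⁻ b (fx≢fy , fx∈ , fy∈) =
      fx≢fy ∘ cong f , ∈B-map⁻-injective b fx∈ , ∈B-map⁻-injective b fy∈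

    mapBlock-injective : Injective _≡_ _≡_ (mapBlock f)
    mapBlock-injective {_ , _ , _} {_ , _ , _} fb≡fb′
      with f-injective (cong proj₁ fb≡fb′)
         | f-injective (cong (proj₁ ∘ proj₂) fb≡fb′)
         | f-injective (cong (proj₂ ∘ proj₂) fb≡fb′)
    ... | refl | refl | refl = refl

  mapBlock-sorted : (∀ {x y} → x < y → f x < f y) → ∀ b → Sorted b → Sorted (mapBlock f b)
  mapBlock-sorted f-mono _ (a<b , b<c) = f-mono a<b , f-mono b<c

PairIn-sym : ∀ {n} {x y : Fin n} {b} → PairIn x y b → PairIn y x b
PairIn-sym (x≢y , x∈ , y∈) = ≢-sym x≢y , y∈ , x∈

Transverse : ∀ {n} {L : Set} → (Fin n → L) → Block n → Set
Transverse f b = ∀ x y → x ∈B b → y ∈B b → f x ≡ f y → x ≡ y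

Transverse-map : ∀ {m n} {L : Set} {f : Fin m → Fin n} {g : Fin n → L} {h : Fin m → L} →
                 (∀ x → g (f x) ≡ h x) → ∀ b → Transverse h b → Transverse g (mapBlock f b)
Transverse-map {f = f} gf≗h b h-transverse _ _ y∈ y′∈ gy≡gy′
  with ∈B-map⁻ f b y∈ | ∈B-map⁻ f b y′∈
... | x , refl , x∈ | x′ , refl , x′∈ =
  cong f (h-transverse x x′ x∈ x′∈ (trans (sym (gf≗h x)) (trans gy≡gy′ (gf≗h x′))))

Transverse-triple : ∀ {n} {L : Set} {f : Fin n → L} {p q r} →
                    f p ≢ f q → f p ≢ f r → f q ≢ f r → Transverse f (p , q , r)
Transverse-triple _  _  _  _ _ (inj₁ refl)        (inj₁ refl)        _ = refl
Transverse-triple pq _  _  _ _ (inj₁ refl)        (inj₂ (inj₁ refl)) e = ⊥-elim (pq e)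
Transverse-triple _  pr _  _ _ (inj₁ refl)        (inj₂ (inj₂ refl)) e = ⊥-elim (pr e)
Transverse-triple pq _  _  _ _ (inj₂ (inj₁ refl)) (inj₁ refl)        e = ⊥-elim (pq (sym e))
Transverse-triple _  _  _  _ _ (inj₂ (inj₁ refl)) (inj₂ (inj₁ refl)) _ = refl
Transverse-triple _  _  qr _ _ (inj₂ (inj₁ refl)) (inj₂ (inj₂ refl)) e = ⊥-elim (qr e)
Transverse-triple _  pr _  _ _ (inj₂ (inj₂ refl)) (inj₁ refl)        e = ⊥-elim (pr (sym e))
Transverse-triple _  _  qr _ _ (inj₂ (inj₂ refl)) (inj₂ (inj₁ refl)) e = ⊥-elim (qr (sym e))
Transverse-triple _  _  _  _ _ (inj₂ (inj₂ refl)) (inj₂ (inj₂ refl)) _ = refl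

shared-block⇒¬Leave : ∀ {n t} {grp : Labelling n t} {B : List (Block n)} {x y} b →
                      b ∈ B → x ∈B b → y ∈B b → ¬ Leave grp B x y
shared-block⇒¬Leave {grp = grp} b b∈B x∈ y∈ (gx≢gy , uncovered) =
  uncovered b b∈B (gx≢gy ∘ cong grp , x∈ , y∈)

_∈ₑ_ : ∀ {n} → Fin n → Fin n × Fin n → Set
z ∈ₑ (a , c) = z ≡ a ⊎ z ≡ c

module _ {n} {Y : Fin n → Set} {F : PairSet n} (F-factor : IsOneFactor Y F) where
  open IsOneFactor F-factor

  endpoint-determines-edge : ∀ {z a c a′ c′} → (a , c) ∈ F → (a′ , c′) ∈ F →
                             z ∈ₑ (a , c) → z ∈ₑ (a′ , c′) → (a , c) ≡ (a′ , c′)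
  endpoint-determines-edge ac∈ ac′∈ (inj₁ refl) (inj₁ refl)
    with refl ← disjoint _ _ _ (inj₁ ac∈) (inj₁ ac′∈) = refl
  endpoint-determines-edge ac∈ ac′∈ (inj₁ refl) (inj₂ refl)
    with refl ← disjoint _ _ _ (inj₁ ac∈) (inj₂ ac′∈) =
    ⊥-elim (<-asym (canonical _ _ ac∈) (canonical _ _ ac′∈))
  endpoint-determines-edge ac∈ ac′∈ (inj₂ refl) (inj₁ refl)
    with refl ← disjoint _ _ _ (inj₂ ac∈) (inj₁ ac′∈) =
    ⊥-elim (<-asym (canonical _ _ ac∈) (canonical _ _ ac′∈))
  endpoint-determines-edge ac∈ ac′∈ (inj₂ refl) (inj₂ refl)
    with refl ← disjoint _ _ _ (inj₂ ac∈) (inj₂ ac′∈) = refl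

GroupOf-splitAt : ∀ {m k t} (f : Labelling m t) (h : Labelling k t) c →
                  GroupOf (λ p → [ f , h ]′ (splitAt m p)) c ↔ (GroupOf f c ⊎ GroupOf h c)
GroupOf-splitAt {m} f h c =
  ↔-trans (Σ-↔ {B = λ q → [ f , h ]′ q ≡ c} (+↔⊎ {m}) ↔-refl) Σ-distribʳ-⊎

module _ {k t : ℕ} where
  open Decidable⇒UIP (_≟_ {suc t}) using (≡-irrelevant)

  GroupOf-const : (c : Fin (suc t)) → GroupOf {k} (λ _ → c) c ↔ Fin k
  GroupOf-const c = mk↔ₛ′ proj₁ (_, refl) (λ _ → refl)
                          (λ (i , e) → cong (i ,_) (≡-irrelevant refl e))

  GroupOf-const-≢ : {c c′ : Fin (suc t)} → c ≢ c′ → GroupOf {k} (λ _ → c) c′ ↔ ⊥ {0ℓ}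
  GroupOf-const-≢ c≢c′ = mk↔ₛ′ (λ (_ , e) → ⊥-elim (c≢c′ e)) (λ ()) (λ ())
                               (λ (_ , e) → ⊥-elim (c≢c′ e))

module Extension (n s t : ℕ) (grp : Labelling n t) where

  old : Fin n → Fin (n + s)
  old x = x ↑ˡ s

  ∞ : Fin s → Fin (n + s)
  ∞ i = n ↑ʳ i

  grp⁺ : Labelling (n + s) t
  grp⁺ p = [ grp , (λ _ → fromℕ t) ]′ (splitAt n p)

  old-injective : Injective _≡_ _≡_ old
  old-injective = ↑ˡ-injective s _ _

  ∞-injective : Injective _≡_ _≡_ ∞
  ∞-injective = ↑ʳ-injective n _ _

  old≢∞ : ∀ {x i} → old x ≢ ∞ i
  old≢∞ {x} {i} e
    with () ← trans (sym (splitAt-↑ˡ n x s)) (trans (cong (splitAt n) e) (splitAt-↑ʳ n s i))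

  old-< : ∀ {x y} → x < y → old x < old y
  old-< {x} {y} x<y rewrite toℕ-↑ˡ x s | toℕ-↑ˡ y s = x<y

  old<∞ : ∀ {x i} → old x < ∞ i
  old<∞ {x} {i} rewrite toℕ-↑ˡ x s | toℕ-↑ʳ n i = ≤-trans (toℕ<n x) (m≤m+n n (toℕ i))

  grp⁺-old : ∀ x → grp⁺ (old x) ≡ grp x
  grp⁺-old x rewrite splitAt-↑ˡ n x s = refl

  grp⁺-∞ : ∀ i → grp⁺ (∞ i) ≡ fromℕ t
  grp⁺-∞ i rewrite splitAt-↑ʳ n s i = refl

  grp⁺-old-≢ : ∀ {x y} → grp x ≢ grp y → grp⁺ (old x) ≢ grp⁺ (old y)
  grp⁺-old-≢ {x} {y} rewrite grp⁺-old x | grp⁺-old y = λ gx≢gy → gx≢gy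

  grp⁺-old-≢⁻ : ∀ {x y} → grp⁺ (old x) ≢ grp⁺ (old y) → grp x ≢ grp y
  grp⁺-old-≢⁻ {x} {y} rewrite grp⁺-old x | grp⁺-old y = λ gx≢gy → gx≢gy

  grp⁺-old-∞-≢ : ∀ {x i} → ¬ InU grp x → grp⁺ (old x) ≢ grp⁺ (∞ i)
  grp⁺-old-∞-≢ {x} {i} rewrite grp⁺-old x | grp⁺-∞ i = λ x∉U → x∉U

  grp⁺-old-∞-≢⁻ : ∀ {x i} → grp⁺ (old x) ≢ grp⁺ (∞ i) → ¬ InU grp x
  grp⁺-old-∞-≢⁻ {x} {i} rewrite grp⁺-old x | grp⁺-∞ i = λ x∉U → x∉U

  data PointView : Fin (n + s) → Set where
    old-point : ∀ x → PointView (old x)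
    new-point : ∀ i → PointView (∞ i)

  pointView : ∀ p → PointView p
  pointView p with splitAt n p in eq
  ... | inj₁ x = subst PointView (splitAt⁻¹-↑ˡ eq) (old-point x)
  ... | inj₂ i = subst PointView (splitAt⁻¹-↑ʳ eq) (new-point i)

  HasType-grp⁺ : ∀ {g u} → HasType g t u grp → HasType g t (u + s) grp⁺
  HasType-grp⁺ {u = u} (small-groups , group-U) =
    (λ i → ↔-trans (GroupOf-splitAt grp U⁺ (inject₁ i))
             (↔-trans (small-groups i ⊎-↔ GroupOf-const-≢ fromℕ≢inject₁) (⊎-identityʳ _ _))) ,
    ↔-trans (GroupOf-splitAt grp U⁺ (fromℕ t))
      (↔-trans (group-U ⊎-↔ GroupOf-const (fromℕ t)) (↔-sym (+↔⊎ {u})))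
    where
    U⁺ : Labelling s t
    U⁺ _ = fromℕ t

  triangle : Fin s → Fin n × Fin n → Block (n + s)
  triangle i (a , c) = old a , old c , ∞ i

  triangle-injective : ∀ {i a c i′ a′ c′} → triangle i (a , c) ≡ triangle i′ (a′ , c′) →
                       i ≡ i′ × a ≡ a′ × c ≡ c′
  triangle-injective e =
    ∞-injective (cong (proj₂ ∘ proj₂) e) ,
    old-injective (cong proj₁ e) ,
    old-injective (cong (proj₁ ∘ proj₂) e)

  triangles : (Fin s → PairSet n) → List (Block (n + s))
  triangles F = concatMap (λ i → map (triangle i) (F i)) (allFin s)

  extendBlocks : List (Block n) → (Fin s → PairSet n) → List (Block (n + s))
  extendBlocks B F = map (mapBlock old) B ++ triangles F

  module _ {B : List (Block n)} {F : Fin s → PairSet n} where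

    old-block∈ : ∀ {b} → b ∈ B → mapBlock old b ∈ extendBlocks B F
    old-block∈ b∈ = ∈-++⁺ˡ (∈-map⁺ (mapBlock old) b∈)

    triangle∈ : ∀ {i a c} → (a , c) ∈ F i → triangle i (a , c) ∈ extendBlocks B F
    triangle∈ {i} ac∈ =
      ∈-++⁺ʳ (map (mapBlock old) B)
        (∈-concatMap⁺ (λ j → map (triangle j) (F j)) (lose (∈-allFin i) (∈-map⁺ (triangle i) ac∈)))

    data BlockView (b : Block (n + s)) : Set where
      old-block      : ∀ {b₀} → b₀ ∈ B → b ≡ mapBlock old b₀ → BlockView b
      triangle-block : ∀ {i a c} → (a , c) ∈ F i → b ≡ triangle i (a , c) → BlockView b

    blockView : ∀ {b} → b ∈ extendBlocks B F → BlockView b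
    blockView b∈ with ∈-++⁻ (map (mapBlock old) B) b∈
    ... | inj₁ b∈old with b₀ , b₀∈ , e ← ∈-map⁻ (mapBlock old) b∈old = old-block b₀∈ e
    ... | inj₂ b∈new
      with i , _ , b∈Fᵢ ← find (∈-concatMap⁻ (λ j → map (triangle j) (F j)) {xs = allFin s} b∈new)
      with _ , ac∈ , e ← ∈-map⁻ (triangle i) b∈Fᵢ = triangle-block ac∈ e

  data TrianglePair (i : Fin s) (a c : Fin n) (x y : Fin (n + s)) : Set where
    spoke : ∀ {z} → z ∈ₑ (a , c) → x ≡ ∞ i → y ≡ old z → TrianglePair i a c x y
    base  : x ≡ old a → y ≡ old c → TrianglePair i a c x y

  trianglePair : ∀ {i a c x y} → PairIn x y (triangle i (a , c)) →
                 TrianglePair i a c x y ⊎ TrianglePair i a c y x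
  trianglePair (x≢y , inj₁ refl        , inj₁ refl)        = ⊥-elim (x≢y refl)
  trianglePair (_   , inj₁ refl        , inj₂ (inj₁ refl)) = inj₁ (base refl refl)
  trianglePair (_   , inj₁ refl        , inj₂ (inj₂ refl)) = inj₂ (spoke (inj₁ refl) refl refl)
  trianglePair (_   , inj₂ (inj₁ refl) , inj₁ refl)        = inj₂ (base refl refl)
  trianglePair (x≢y , inj₂ (inj₁ refl) , inj₂ (inj₁ refl)) = ⊥-elim (x≢y refl)
  trianglePair (_   , inj₂ (inj₁ refl) , inj₂ (inj₂ refl)) = inj₂ (spoke (inj₂ refl) refl refl)
  trianglePair (_   , inj₂ (inj₂ refl) , inj₁ refl)        = inj₁ (spoke (inj₁ refl) refl refl)
  trianglePair (_   , inj₂ (inj₂ refl) , inj₂ (inj₁ refl)) = inj₁ (spoke (inj₂ refl) refl refl)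
  trianglePair (x≢y , inj₂ (inj₂ refl) , inj₂ (inj₂ refl)) = ⊥-elim (x≢y refl)

  module _ {B : List (Block n)} {F : Fin s → PairSet n}
           (B-partial : IsPartialGDD grp B) (F-factorises : LeaveFactorisation grp B s F) where
    open IsPartialGDD B-partial
    open LeaveFactorisation F-factorises

    edge-canonical : ∀ {i a c} → (a , c) ∈ F i → a < c
    edge-canonical {i} ac∈ = IsOneFactor.canonical (factors i) _ _ ac∈

    edge-in-leave : ∀ {i a c} → (a , c) ∈ F i → Leave grp B a c
    edge-in-leave {i} ac∈ = ⊆leave i _ _ (inj₁ ac∈)

    edge-avoids-U : ∀ {i a c} → (a , c) ∈ F i → ¬ InU grp a × ¬ InU grp c
    edge-avoids-U {i} ac∈ = IsOneFactor.inside (factors i) _ _ ac∈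

    C : List (Block (n + s))
    C = extendBlocks B F

    sorted⁺ : ∀ b → b ∈ C → Sorted b
    sorted⁺ _ b∈ with blockView b∈
    ... | old-block b₀∈ refl = mapBlock-sorted old old-< _ (sorted _ b₀∈)
    ... | triangle-block ac∈ refl = old-< (edge-canonical ac∈) , old<∞

    transverse⁺ : ∀ b → b ∈ C → Transverse grp⁺ b
    transverse⁺ _ b∈ with blockView b∈
    ... | old-block b₀∈ refl = Transverse-map grp⁺-old _ (transverse _ b₀∈)
    ... | triangle-block ac∈ refl =
      Transverse-triple (grp⁺-old-≢ (proj₁ (edge-in-leave ac∈)))
                        (grp⁺-old-∞-≢ (proj₁ (edge-avoids-U ac∈)))
                        (grp⁺-old-∞-≢ (proj₂ (edge-avoids-U ac∈)))

    trianglePairs-agree : ∀ {i a c i′ a′ c′ x y} → (a , c) ∈ F i → (a′ , c′) ∈ F i′ →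
                          TrianglePair i a c x y → TrianglePair i′ a′ c′ x y →
                          triangle i (a , c) ≡ triangle i′ (a′ , c′)
    trianglePairs-agree {i} ac∈ ac′∈ (spoke z∈ refl refl) (spoke z∈′ e e′)
      with refl ← ∞-injective e | refl ← old-injective e′ =
      cong (triangle i) (endpoint-determines-edge (factors i) ac∈ ac′∈ z∈ z∈′)
    trianglePairs-agree _ _ (spoke _ refl _) (base e _) = ⊥-elim (old≢∞ (sym e))
    trianglePairs-agree _ _ (base refl _) (spoke _ e _) = ⊥-elim (old≢∞ e)
    trianglePairs-agree {i} {i′ = i′} ac∈ ac′∈ (base refl refl) (base e e′)
      with refl ← old-injective e | refl ← old-injective e′
      with refl ← pairwise i i′ _ _ (inj₁ ac∈) (inj₁ ac′∈) = refl

    trianglePairs-opposite : ∀ {i a c i′ a′ c′ x y} → (a , c) ∈ F i → (a′ , c′) ∈ F i′ →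
                             TrianglePair i a c x y → ¬ TrianglePair i′ a′ c′ y x
    trianglePairs-opposite _ _ (spoke _ refl _) (spoke _ _ e) = old≢∞ (sym e)
    trianglePairs-opposite _ _ (spoke _ refl _) (base _ e) = old≢∞ (sym e)
    trianglePairs-opposite _ _ (base _ refl) (spoke _ e _) = old≢∞ e
    trianglePairs-opposite ac∈ ac′∈ (base refl refl) (base e e′)
      with refl ← old-injective e | refl ← old-injective e′ =
      <-asym (edge-canonical ac∈) (edge-canonical ac′∈)

    triangles-agree : ∀ {i a c i′ a′ c′ x y} → (a , c) ∈ F i → (a′ , c′) ∈ F i′ →
                      PairIn x y (triangle i (a , c)) → PairIn x y (triangle i′ (a′ , c′)) →
                      triangle i (a , c) ≡ triangle i′ (a′ , c′)
    triangles-agree ac∈ ac′∈ p p′ with trianglePair p | trianglePair p′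
    ... | inj₁ tp | inj₁ tp′ = trianglePairs-agree ac∈ ac′∈ tp tp′
    ... | inj₂ tp | inj₂ tp′ = trianglePairs-agree ac∈ ac′∈ tp tp′
    ... | inj₁ tp | inj₂ tp′ = ⊥-elim (trianglePairs-opposite ac∈ ac′∈ tp tp′)
    ... | inj₂ tp | inj₁ tp′ = ⊥-elim (trianglePairs-opposite ac∈ ac′∈ tp tp′)

    old-trianglePair : ∀ {b₀ i a c x y} → b₀ ∈ B → (a , c) ∈ F i →
                       PairIn x y (mapBlock old b₀) → ¬ TrianglePair i a c x y
    old-trianglePair {b₀} _ _ (_ , ∞∈ , _) (spoke _ refl _)
      with _ , e , _ ← ∈B-map⁻ old b₀ ∞∈ = old≢∞ (sym e)
    old-trianglePair {b₀} b₀∈ ac∈ p (base refl refl) =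
      proj₂ (edge-in-leave ac∈) b₀ b₀∈ (PairIn-map⁻ old old-injective b₀ p)

    old-triangle : ∀ {b₀ i a c x y} → b₀ ∈ B → (a , c) ∈ F i →
                   PairIn x y (mapBlock old b₀) → ¬ PairIn x y (triangle i (a , c))
    old-triangle b₀∈ ac∈ p q with trianglePair q
    ... | inj₁ tp = old-trianglePair b₀∈ ac∈ p tp
    ... | inj₂ tp = old-trianglePair b₀∈ ac∈ (PairIn-sym p) tp

    old-blocks-agree : ∀ {b₀ b₀′ x y} → grp⁺ x ≢ grp⁺ y → b₀ ∈ B → b₀′ ∈ B →
                       PairIn x y (mapBlock old b₀) → PairIn x y (mapBlock old b₀′) →
                       mapBlock old b₀ ≡ mapBlock old b₀′
    old-blocks-agree {b₀} {b₀′} gx≢gy b₀∈ b₀′∈ p@(_ , x∈ , y∈) p′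
      with x₀ , refl , _ ← ∈B-map⁻ old b₀ x∈
         | y₀ , refl , _ ← ∈B-map⁻ old b₀ y∈ =
      cong (mapBlock old)
        (atMostOne x₀ y₀ (grp⁺-old-≢⁻ gx≢gy) b₀ b₀′ b₀∈ b₀′∈
           (PairIn-map⁻ old old-injective b₀ p) (PairIn-map⁻ old old-injective b₀′ p′))

    atMostOne⁺ : ∀ x y → grp⁺ x ≢ grp⁺ y → ∀ b b′ → b ∈ C → b′ ∈ C →
                 PairIn x y b → PairIn x y b′ → b ≡ b′
    atMostOne⁺ _ _ gx≢gy _ _ b∈ b′∈ p p′ with blockView b∈ | blockView b′∈
    ... | old-block b₀∈ refl    | old-block b₀′∈ refl   = old-blocks-agree gx≢gy b₀∈ b₀′∈ p p′
    ... | old-block b₀∈ refl    | triangle-block ac∈ refl = ⊥-elim (old-triangle b₀∈ ac∈ p p′)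
    ... | triangle-block ac∈ refl | old-block b₀∈ refl  = ⊥-elim (old-triangle b₀∈ ac∈ p′ p)
    ... | triangle-block ac∈ refl | triangle-block ac′∈ refl = triangles-agree ac∈ ac′∈ p p′

    triangle-through-edge : ∀ {i x z} → HasEdge (F i) x z →
                            ∃ λ b → b ∈ C × old x ∈B b × old z ∈B b × ∞ i ∈B b
    triangle-through-edge (inj₁ xz∈) =
      _ , triangle∈ xz∈ , inj₁ refl , inj₂ (inj₁ refl) , inj₂ (inj₂ refl)
    triangle-through-edge (inj₂ zx∈) =
      _ , triangle∈ zx∈ , inj₂ (inj₁ refl) , inj₁ refl , inj₂ (inj₂ refl)

    spoke-through : ∀ x i → ¬ InU grp x → ∃ λ b → b ∈ C × old x ∈B b × ∞ i ∈B b
    spoke-through x i x∉U with _ , xz∈ ← IsOneFactor.covers (factors i) x x∉U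
      with b , b∈ , x∈ , _ , ∞∈ ← triangle-through-edge xz∈ = b , b∈ , x∈ , ∞∈

    ¬Leave-old : ∀ x y → ¬ Leave grp⁺ C (old x) (old y)
    ¬Leave-old x y leave⁺@(gx≢gy , uncovered)
      with _ , xy∈ ← leave⊆ x y (grp⁺-old-≢⁻ gx≢gy , λ b₀ b₀∈ p →
                        uncovered _ (old-block∈ b₀∈) (PairIn-map⁺ old old-injective b₀ p))
      with b , b∈ , x∈ , y∈ , _ ← triangle-through-edge xy∈ =
      shared-block⇒¬Leave {grp = grp⁺} b b∈ x∈ y∈ leave⁺

    ¬Leave⁺ : ∀ x y → ¬ Leave grp⁺ C x y
    ¬Leave⁺ x y with pointView x | pointView y
    ... | old-point x₀ | old-point y₀ = ¬Leave-old x₀ y₀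
    ... | old-point x₀ | new-point i = λ leave⁺ →
      let b , b∈ , x∈ , ∞∈ = spoke-through x₀ i (grp⁺-old-∞-≢⁻ (proj₁ leave⁺))
      in  shared-block⇒¬Leave {grp = grp⁺} b b∈ x∈ ∞∈ leave⁺
    ... | new-point i | old-point y₀ = λ leave⁺ →
      let b , b∈ , y∈ , ∞∈ = spoke-through y₀ i (grp⁺-old-∞-≢⁻ (≢-sym (proj₁ leave⁺)))
      in  shared-block⇒¬Leave {grp = grp⁺} b b∈ ∞∈ y∈ leave⁺
    ... | new-point i | new-point j = λ (gx≢gy , _) → gx≢gy (trans (grp⁺-∞ i) (sym (grp⁺-∞ j)))

    IsGDD-extendBlocks : IsGDD grp⁺ C
    IsGDD-extendBlocks =
      record { sorted = sorted⁺ ; transverse = transverse⁺ ; atMostOne = atMostOne⁺ } ,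
      ¬Leave⁺

  extendBlocks-disjoint : ∀ {B₁ B₂ F¹ F²} → DisjointBlocks B₁ B₂ →
                          (∀ i x y → HasEdge (F¹ i) x y → ¬ HasEdge (F² i) x y) →
                          DisjointBlocks (extendBlocks B₁ F¹) (extendBlocks B₂ F²)
  extendBlocks-disjoint {B₂ = B₂} B₁#B₂ F¹#F² _ b∈₁ b∈₂ with blockView b∈₁ | blockView b∈₂
  ... | old-block b₀∈ refl | old-block b₀′∈ e =
    B₁#B₂ _ b₀∈ (subst (_∈ B₂) (sym (mapBlock-injective old old-injective e)) b₀′∈)
  ... | old-block _ refl | triangle-block _ e = old≢∞ (cong (proj₂ ∘ proj₂) e)
  ... | triangle-block _ refl | old-block _ e = old≢∞ (cong (proj₂ ∘ proj₂) (sym e))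
  ... | triangle-block ac∈ refl | triangle-block ac′∈ e
    with refl , refl , refl ← triangle-injective e = F¹#F² _ _ _ (inj₁ ac∈) (inj₁ ac′∈)

lemma3p1 : ∀ (g t u s n : ℕ) (grp : Labelling n t) (B₁ B₂ : List (Block n)) →
    HasType g t u grp →
    IsPartialGDD grp B₁ → IsPartialGDD grp B₂ → DisjointBlocks B₁ B₂ →
    (F¹ F² : Fin s → PairSet n) →
    LeaveFactorisation grp B₁ s F¹ → LeaveFactorisation grp B₂ s F² →
    (∀ i x y → HasEdge (F¹ i) x y → ¬ HasEdge (F² i) x y) →
    Σ ℕ λ m → Σ (Labelling m t) λ grp' → Σ (List (Block m)) λ C₁ → Σ (List (Block m)) λ C₂ →
    HasType g t (u + s) grp' × IsGDD grp' C₁ × IsGDD grp' C₂ × DisjointBlocks C₁ C₂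
lemma3p1 g t u s n grp B₁ B₂ type B₁-partial B₂-partial B₁#B₂
         F¹ F² F¹-factorises F²-factorises F¹#F² =
  n + s , grp⁺ , extendBlocks B₁ F¹ , extendBlocks B₂ F² ,
  HasType-grp⁺ type ,
  IsGDD-extendBlocks B₁-partial F¹-factorises ,
  IsGDD-extendBlocks B₂-partial F²-factorises ,
  extendBlocks-disjoint B₁#B₂ F¹#F²
  where open Extension n s t grp
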